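{- Let $\mathcal{F}$ be a finite family of connected graphs, let $\ell\ge1$ be an integer, and let $d$ be the largest diameter of a graph in $\mathcal{F}$. Let $G$ be a graph such that every vertex of $G$ belongs to some subgraph of $G$ isomorphic to a graph in $\mathcal{F}$, and let $k\ge0$ be an integer. If $G$ does not contain $k$ subgraphs $G_1,\dots,G_k$, each isomorphic to a graph in $\mathcal{F}$, pairwise at distance at least $\ell$, then $(G,k)$ is a Yes-instance of $(2d+\ell)$-Dominating Set, i.e., there is a set $D\subseteq V(G)$ with $|D|\le k$ such that every vertex of $G$ is at distance at most $2d+\ell$ from some vertex of $D$.
   Context: Graphs are finite, simple and undirected; $d_G$ denotes the shortest-path distance in $G$, and two subgraphs $G_i,G_j$ are at distance at least $\ell$ if $\min\{d_G(u,v):u\in V(G_i),v\in V(G_j)\}\ge\ell$. The hypothesis on $G$ is that $G$ is reduced under the rule "delete a vertex that belongs to no subgraph of $G$ isomorphic to a graph in $\mathcal{F}$". -}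

module Defs where

open import Data.Nat using (ℕ; zero; suc; _≤_; _<_; _+_; _*_)
open import Data.Fin using (Fin)
open import Data.Fin.Subset using (Subset; _∈_; ∣_∣)
open import Data.Bool using (Bool; true; false)
open import Data.Product using (Σ; ∃; ∃-syntax; _×_; _,_)
open import Data.List using (List)
import Data.List.Membership.Propositional as LM
open import Relation.Binary.PropositionalEquality using (_≡_; _≢_)
open import Relation.Nullary using (¬_)
open import Function.Definitions using (Injective)

record Graph : Set where
  field
    n      : ℕ
    adj    : Fin n → Fin n → Bool
    adj-sym    : ∀ u v → adj u v ≡ adj v u
    adj-irrefl : ∀ v → adj v v ≡ false

open Graph public

V : Graph → Set
V G = Fin (n G)

data Walk (G : Graph) : V G → V G → ℕ → Set where
  nil  : ∀ {u} → Walk G u u zero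
  cons : ∀ {u v w k} → adj G u v ≡ true → Walk G v w k → Walk G u w (suc k)

DistLe : (G : Graph) → V G → V G → ℕ → Set
DistLe G u v r = ∃[ k ] (k ≤ r × Walk G u v k)

DistEq : (G : Graph) → V G → V G → ℕ → Set
DistEq G u v r = DistLe G u v r × (∀ m → m < r → ¬ DistLe G u v m)

Connected : Graph → Set
Connected G = ∀ (u v : V G) → ∃[ r ] DistLe G u v r

HasDiameter : Graph → ℕ → Set
HasDiameter H d = (∀ u v → DistLe H u v d) × ∃[ u ] ∃[ v ] DistEq H u v d

MaxDiameter : List Graph → ℕ → Set
MaxDiameter 𝓕 d =
  (∀ {H} → H LM.∈ 𝓕 → ∀ u v → DistLe H u v d) ×
  ∃[ H ] (H LM.∈ 𝓕 × HasDiameter H d)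

-- A subgraph of G isomorphic to H, given by an injective edge-preserving
-- map; the subgraph is the image (vertices f(V H), edges f(E H)).
record Embedding (H G : Graph) : Set where
  field
    map       : V H → V G
    injective : Injective _≡_ _≡_ map
    preserves : ∀ u v → adj H u v ≡ true → adj G (map u) (map v) ≡ true

open Embedding public

FCopy : List Graph → Graph → Set
FCopy 𝓕 G = Σ Graph (λ H → H LM.∈ 𝓕 × Embedding H G)

copyMap : ∀ {𝓕 G} → (c : FCopy 𝓕 G) → V (Σ.proj₁ c) → V G
copyMap (H , _ , e) = map e

InCopy : ∀ {𝓕 G} → V G → FCopy 𝓕 G → Set
InCopy v c = ∃[ u ] (copyMap c u ≡ v)

FarApart : ∀ {𝓕 G} → ℕ → FCopy 𝓕 G → FCopy 𝓕 G → Set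
FarApart {G = G} ℓ c₁ c₂ =
  ∀ u v → ¬ DistLe G (copyMap c₁ u) (copyMap c₂ v) (Data.Nat.pred ℓ)
  where import Data.Nat

HasFarPacking : List Graph → ℕ → Graph → ℕ → Set
HasFarPacking 𝓕 ℓ G k =
  Σ (Fin k → FCopy 𝓕 G) λ cs → ∀ i j → i ≢ j → FarApart ℓ (cs i) (cs j)

RDominating : ℕ → Graph → ℕ → Set
RDominating r G k =
  Σ (Subset (n G)) λ D → ∣ D ∣ ≤ k × (∀ v → ∃[ u ] (u ∈ D × DistLe G u v r))

-- Choose greedily a maximal family P of F-copies that are pairwise at distance
-- at least ℓ, each copy taken as one containing a given vertex. By hypothesis
-- |P| < k. Every vertex v lies in a copy c_v which is in P or at distance at
-- most ℓ - 1 from a copy p in P; since copies have diameter at most d, v is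
-- within d + (ℓ - 1) + d of any vertex of p. So one vertex per copy of P
-- forms a (2d + ℓ)-dominating set of size less than k.
module Submission where

open import Defs
open import Data.Nat using (ℕ; _≤_; _+_; _*_)
open import Data.List using (List)
open import Data.Product using (_×_; ∃)
import Data.List.Membership.Propositional as LM
open LM using (find)
open import Relation.Nullary using (¬_)

open import Data.Nat using (zero; suc; pred; z≤n; s≤s)
open import Data.Nat.Properties
  using (≤-trans; +-suc; +-mono-≤; +-monoʳ-≤; +-monoˡ-≤; pred[n]≤n; ≰⇒>; <⇒≤; _≤?_; module ≤-Reasoning)
open import Data.Nat.Tactic.RingSolver using (solve-∀)
open import Data.Fin using (Fin; inject≤) renaming (zero to fzero; suc to fsuc)
open import Data.Fin.Properties using (any?; inject≤-injective) renaming (_≟_ to _≟ᶠ_)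
open import Data.Fin.Subset using (Subset; _∈_; ∣_∣; ⁅_⁆; _∪_; ⋃; inside; outside)
open import Data.Fin.Subset.Properties using (∣⊥∣≡0; ∣⁅x⁆∣≡1; x∈⁅x⁆; x∈p∪q⁺; ∣p∣≤∣x∷p∣)
open import Data.Bool using (true) renaming (_≟_ to _≟ᵇ_)
open import Data.Vec using ([]; _∷_)
open import Data.Product using (Σ-syntax; ∃-syntax; _,_; proj₁; proj₂)
open import Data.Sum using (_⊎_; inj₁; inj₂)
open import Data.Empty using (⊥-elim)
open import Data.List using ([]; _∷_; length; lookup; allFin)
import Data.List as List
open import Data.List.Relation.Unary.All using (All; []; _∷_)
import Data.List.Relation.Unary.All as All
open import Data.List.Relation.Unary.Any using (Any; here; there)
import Data.List.Relation.Unary.Any as Any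
open import Data.List.Relation.Unary.Any.Properties using (map⁺)
open import Data.List.Properties using (length-map)
open import Data.List.Relation.Unary.AllPairs using (AllPairs; []; _∷_)
import Data.List.Relation.Unary.AllPairs.Properties as AllPairs
open import Data.List.Membership.Propositional.Properties using (∈-map⁺; ∈-allFin; ∈-lookup)
open import Function using (_on_; _∘_)
open import Level using (0ℓ)
open import Relation.Binary.Core using (Rel)
open import Relation.Binary.Definitions using (Symmetric)
open import Relation.Binary.PropositionalEquality using (_≡_; refl; sym; _≢_; cong; subst)
open import Relation.Nullary using (Dec; yes; no)
import Relation.Nullary.Decidable as Dec
open import Relation.Nullary.Decidable using (_×-dec_)

module _ {G : Graph} where

  snocʷ : ∀ {u v w k} → Walk G u v k → adj G v w ≡ true → Walk G u w (suc k)
  snocʷ nil        e = cons e nil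
  snocʷ (cons f p) e = cons f (snocʷ p e)

  reverseʷ : ∀ {u v k} → Walk G u v k → Walk G v u k
  reverseʷ nil                         = nil
  reverseʷ {u} (cons {v = w} e p) = snocʷ (reverseʷ p) (subst (_≡ true) (adj-sym G u w) e)

  _++ʷ_ : ∀ {u v w k m} → Walk G u v k → Walk G v w m → Walk G u w (k + m)
  nil      ++ʷ q = q
  cons e p ++ʷ q = cons e (p ++ʷ q)

  distLe-refl : ∀ {u r} → DistLe G u u r
  distLe-refl = 0 , z≤n , nil

  distLe-sym : ∀ {u v r} → DistLe G u v r → DistLe G v u r
  distLe-sym (k , k≤r , p) = k , k≤r , reverseʷ p

  distLe-trans : ∀ {u v w r s} → DistLe G u v r → DistLe G v w s → DistLe G u w (r + s)
  distLe-trans (k , k≤r , p) (m , m≤s , q) = k + m , +-mono-≤ k≤r m≤s , p ++ʷ q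

  distLe-mono : ∀ {u v r s} → r ≤ s → DistLe G u v r → DistLe G u v s
  distLe-mono r≤s (k , k≤r , p) = k , ≤-trans k≤r r≤s , p

  distLe-cons : ∀ {u v w r} → adj G u w ≡ true → DistLe G w v r → DistLe G u v (suc r)
  distLe-cons e (k , k≤r , p) = suc k , s≤s k≤r , cons e p

  distLe-uncons : ∀ {u v r} → u ≢ v → DistLe G u v (suc r) →
                  ∃[ w ] (adj G u w ≡ true × DistLe G w v r)
  distLe-uncons u≢v (_ , _ , nil)                      = ⊥-elim (u≢v refl)
  distLe-uncons u≢v (suc k , s≤s k≤r , cons {v = w} e p) = w , e , k , k≤r , p

distLe? : (G : Graph) → ∀ r u v → Dec (DistLe G u v r)
distLe? G r u v with u ≟ᶠ v
... | yes refl = yes distLe-refl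
distLe? G zero    u v | no u≢v = no λ { (_ , z≤n , nil) → u≢v refl }
distLe? G (suc r) u v | no u≢v =
  Dec.map′ (λ (w , e , δ) → distLe-cons e δ) (distLe-uncons u≢v)
           (any? λ w → (adj G u w ≟ᵇ true) ×-dec distLe? G r w v)

map-walk : ∀ {H G} (e : Embedding H G) {u v k} → Walk H u v k → Walk G (map e u) (map e v) k
map-walk e nil        = nil
map-walk e (cons f p) = cons (preserves e _ _ f) (map-walk e p)

∣p∪q∣≤∣p∣+∣q∣ : ∀ {n} (p q : Subset n) → ∣ p ∪ q ∣ ≤ ∣ p ∣ + ∣ q ∣
∣p∪q∣≤∣p∣+∣q∣ []            []            = z≤n
∣p∪q∣≤∣p∣+∣q∣ (outside ∷ p) (outside ∷ q) = ∣p∪q∣≤∣p∣+∣q∣ p q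
∣p∪q∣≤∣p∣+∣q∣ (outside ∷ p) (inside ∷ q)  =
  subst (suc ∣ p ∪ q ∣ ≤_) (sym (+-suc ∣ p ∣ ∣ q ∣)) (s≤s (∣p∪q∣≤∣p∣+∣q∣ p q))
∣p∪q∣≤∣p∣+∣q∣ (inside ∷ p)  (y ∷ q)       =
  s≤s (≤-trans (∣p∪q∣≤∣p∣+∣q∣ p q) (+-monoʳ-≤ ∣ p ∣ (∣p∣≤∣x∷p∣ y q)))

∣⋃⁅xs⁆∣≤length : ∀ {n} (xs : List (Fin n)) → ∣ ⋃ (List.map ⁅_⁆ xs) ∣ ≤ length xs
∣⋃⁅xs⁆∣≤length {n} []       = subst (_≤ 0) (sym (∣⊥∣≡0 n)) z≤n
∣⋃⁅xs⁆∣≤length     (x ∷ xs) = begin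
  ∣ ⁅ x ⁆ ∪ ⋃ (List.map ⁅_⁆ xs) ∣         ≤⟨ ∣p∪q∣≤∣p∣+∣q∣ ⁅ x ⁆ _ ⟩
  ∣ ⁅ x ⁆ ∣ + ∣ ⋃ (List.map ⁅_⁆ xs) ∣     ≡⟨ cong (_+ _) (∣⁅x⁆∣≡1 x) ⟩
  suc ∣ ⋃ (List.map ⁅_⁆ xs) ∣             ≤⟨ s≤s (∣⋃⁅xs⁆∣≤length xs) ⟩
  suc (length xs)                         ∎
  where open ≤-Reasoning

∈⇒∈⋃⁅xs⁆ : ∀ {n} {x : Fin n} {xs} → x LM.∈ xs → x ∈ ⋃ (List.map ⁅_⁆ xs)
∈⇒∈⋃⁅xs⁆ (here refl) = x∈p∪q⁺ (inj₁ (x∈⁅x⁆ _))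
∈⇒∈⋃⁅xs⁆ (there x∈xs) = x∈p∪q⁺ (inj₂ (∈⇒∈⋃⁅xs⁆ x∈xs))

module _ {a r s} {A : Set a} {R : Rel A r} {S : Rel A s} (R-or-S : ∀ x y → R x y ⊎ S x y) where

  all-or-any : ∀ x ys → All (R x) ys ⊎ Any (S x) ys
  all-or-any x []       = inj₁ []
  all-or-any x (y ∷ ys) with R-or-S x y | all-or-any x ys
  ... | inj₂ sxy | _         = inj₂ (here sxy)
  ... | inj₁ rxy | inj₁ rxys = inj₁ (rxy ∷ rxys)
  ... | inj₁ _   | inj₂ sxys = inj₂ (there sxys)

  greedy-maximal-allPairs : (xs : List A) →
    ∃[ ps ] (AllPairs R ps × All (λ x → Any (λ p → x ≡ p ⊎ S x p) ps) xs)
  greedy-maximal-allPairs []       = [] , [] , []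
  greedy-maximal-allPairs (x ∷ xs) with greedy-maximal-allPairs xs
  ... | ps , pairs , blocked with all-or-any x ps
  ... | inj₁ rxps = x ∷ ps , rxps ∷ pairs , here (inj₁ refl) ∷ All.map there blocked
  ... | inj₂ sxps = ps , pairs , Any.map inj₂ sxps ∷ blocked

allPairs-lookup : ∀ {a r} {A : Set a} {R : Rel A r} → Symmetric R →
                  ∀ {xs} → AllPairs R xs → ∀ {i j} → i ≢ j → R (lookup xs i) (lookup xs j)
allPairs-lookup R-sym (_ ∷ _)     {fzero}  {fzero}  i≢j = ⊥-elim (i≢j refl)
allPairs-lookup R-sym (rx ∷ _)    {fzero}  {fsuc j} _   = All.lookup rx (∈-lookup j)
allPairs-lookup R-sym (rx ∷ _)    {fsuc i} {fzero}  _   = R-sym (All.lookup rx (∈-lookup i))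
allPairs-lookup R-sym (_ ∷ pairs) {fsuc i} {fsuc j} i≢j =
  allPairs-lookup R-sym pairs (λ i≡j → i≢j (cong fsuc i≡j))

module _ {𝓕 : List Graph} {G : Graph} (ℓ : ℕ) where

  Near : Rel (FCopy 𝓕 G) 0ℓ
  Near c₁ c₂ = ∃[ u ] ∃[ v ] DistLe G (copyMap c₁ u) (copyMap c₂ v) (pred ℓ)

  near-or-farApart : ∀ c₁ c₂ → Near c₁ c₂ ⊎ FarApart ℓ c₁ c₂
  near-or-farApart c₁ c₂ with any? (λ u → any? (λ v → distLe? G (pred ℓ) (copyMap c₁ u) (copyMap c₂ v)))
  ... | yes near = inj₁ near
  ... | no ¬near = inj₂ λ u v δ → ¬near (u , v , δ)

  Close : Rel (FCopy 𝓕 G) 0ℓ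
  Close c₁ c₂ = Near c₁ c₂ ⊎ Near c₂ c₁

  MutuallyFar : Rel (FCopy 𝓕 G) 0ℓ
  MutuallyFar c₁ c₂ = FarApart {𝓕} {G} ℓ c₁ c₂ × FarApart {𝓕} {G} ℓ c₂ c₁

  mutuallyFar-sym : Symmetric MutuallyFar
  mutuallyFar-sym (far₁₂ , far₂₁) = far₂₁ , far₁₂

  mutuallyFar-or-close : ∀ c₁ c₂ → MutuallyFar c₁ c₂ ⊎ Close c₁ c₂
  mutuallyFar-or-close c₁ c₂ with near-or-farApart c₁ c₂ | near-or-farApart c₂ c₁
  ... | inj₁ near₁₂ | _           = inj₂ (inj₁ near₁₂)
  ... | inj₂ _      | inj₁ near₂₁ = inj₂ (inj₂ near₂₁)
  ... | inj₂ far₁₂  | inj₂ far₂₁  = inj₁ (far₁₂ , far₂₁)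

  allPairs-mutuallyFar⇒farPacking : ∀ {k} (cs : List (FCopy 𝓕 G)) →
    AllPairs MutuallyFar cs → k ≤ length cs → HasFarPacking 𝓕 ℓ G k
  allPairs-mutuallyFar⇒farPacking cs pairs k≤ =
    (λ i → lookup cs (inject≤ i k≤)) ,
    λ i j i≢j → proj₁ (allPairs-lookup (λ {x y} → mutuallyFar-sym {x} {y}) pairs
                         {inject≤ i k≤} {inject≤ j k≤} (i≢j ∘ inject≤-injective k≤ k≤ i j))

d+[ℓ+d]≡2d+ℓ : ∀ d ℓ → d + (ℓ + d) ≡ 2 * d + ℓ
d+[ℓ+d]≡2d+ℓ = solve-∀

copy-distLe : ∀ {𝓕 G d} → (∀ {H} → H LM.∈ 𝓕 → ∀ u v → DistLe H u v d) →
              (c : FCopy 𝓕 G) → ∀ u v → DistLe G (copyMap c u) (copyMap c v) d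
copy-distLe diam (_ , H∈𝓕 , e) u v with diam H∈𝓕 u v
... | k , k≤d , p = k , k≤d , map-walk e p

RootedCopy : List Graph → Graph → Set
RootedCopy 𝓕 G = Σ[ c ∈ FCopy 𝓕 G ] V (proj₁ c)

root : ∀ {𝓕 G} → RootedCopy 𝓕 G → V G
root (c , u) = copyMap c u

rootedAt : ∀ {𝓕 G v} → ∃ (λ (c : FCopy 𝓕 G) → InCopy v c) → RootedCopy 𝓕 G
rootedAt (c , u , _) = c , u

root-rootedAt : ∀ {𝓕 G v} (v∈c : ∃ λ (c : FCopy 𝓕 G) → InCopy v c) → root (rootedAt v∈c) ≡ v
root-rootedAt (_ , _ , eq) = eq

module _ {𝓕 : List Graph} {G : Graph} {ℓ d : ℕ}
         (diam : ∀ {H} → H LM.∈ 𝓕 → ∀ u v → DistLe H u v d) where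

  close⇒roots-distLe : ∀ (x p : RootedCopy 𝓕 G) → Close ℓ (proj₁ x) (proj₁ p) →
    DistLe G (root p) (root x) (d + (pred ℓ + d))
  close⇒roots-distLe (cx , a) (cp , b) (inj₁ (u , v , δ)) =
    distLe-trans (copy-distLe diam cp b v) (distLe-trans (distLe-sym δ) (copy-distLe diam cx u a))
  close⇒roots-distLe (cx , a) (cp , b) (inj₂ (v , u , δ)) =
    distLe-trans (copy-distLe diam cp b v) (distLe-trans δ (copy-distLe diam cx u a))

  d+[pred[ℓ]+d]≤2d+ℓ : d + (pred ℓ + d) ≤ 2 * d + ℓ
  d+[pred[ℓ]+d]≤2d+ℓ = begin
    d + (pred ℓ + d) ≤⟨ +-monoʳ-≤ d (+-monoˡ-≤ d pred[n]≤n) ⟩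
    d + (ℓ + d)      ≡⟨ d+[ℓ+d]≡2d+ℓ d ℓ ⟩
    2 * d + ℓ        ∎
    where open ≤-Reasoning

  blocked⇒roots-distLe : ∀ (x p : RootedCopy 𝓕 G) →
    x ≡ p ⊎ Close ℓ (proj₁ x) (proj₁ p) →
    DistLe G (root p) (root x) (2 * d + ℓ)
  blocked⇒roots-distLe x .x (inj₁ refl) = distLe-refl
  blocked⇒roots-distLe x p  (inj₂ close) =
    distLe-mono d+[pred[ℓ]+d]≤2d+ℓ (close⇒roots-distLe x p close)

  blocked⇒dominatedByRoots : ∀ {v} (x : RootedCopy 𝓕 G) → root x ≡ v → ∀ {ps} →
    Any (λ p → x ≡ p ⊎ Close ℓ (proj₁ x) (proj₁ p)) ps →
    Any (λ u → DistLe G u v (2 * d + ℓ)) (List.map root ps)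
  blocked⇒dominatedByRoots x refl blocked = map⁺ (Any.map (blocked⇒roots-distLe x _) blocked)

dominatingSet : ∀ {G r k} (us : List (V G)) → length us ≤ k →
                (∀ v → Any (λ u → DistLe G u v r) us) → RDominating r G k
dominatingSet us us≤k dominates =
  ⋃ (List.map ⁅_⁆ us) , ≤-trans (∣⋃⁅xs⁆∣≤length us) us≤k ,
  λ v → let u , u∈us , δ = find (dominates v) in u , ∈⇒∈⋃⁅xs⁆ u∈us , δ

proposition8p4 : (𝓕 : List Graph) → (∀ {H} → H LM.∈ 𝓕 → Connected H) →
    (ℓ : ℕ) → 1 ≤ ℓ → (d : ℕ) → MaxDiameter 𝓕 d →
    (G : Graph) → (∀ (v : V G) → ∃ λ (c : FCopy 𝓕 G) → InCopy v c) →
    (k : ℕ) → ¬ HasFarPacking 𝓕 ℓ G k →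
    RDominating (2 * d + ℓ) G k
proposition8p4 𝓕 _ ℓ _ d (diam , _) G cov k noPacking
  with greedy-maximal-allPairs {R = MutuallyFar ℓ on proj₁}
         (λ x y → mutuallyFar-or-close ℓ (proj₁ x) (proj₁ y))
         (List.map (rootedAt ∘ cov) (allFin (n G)))
... | P , pairs , blocked with k ≤? length P
... | yes k≤∣P∣ = ⊥-elim (noPacking (allPairs-mutuallyFar⇒farPacking ℓ (List.map proj₁ P)
                                      (AllPairs.map⁺ pairs) (subst (k ≤_) (sym (length-map proj₁ P)) k≤∣P∣)))
... | no k≰∣P∣ = dominatingSet (List.map root P)
                   (subst (_≤ k) (sym (length-map root P)) (<⇒≤ (≰⇒> k≰∣P∣)))
                   λ v → blocked⇒dominatedByRoots diam (rootedAt (cov v)) (root-rootedAt (cov v))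
                           (All.lookup blocked (∈-map⁺ (rootedAt ∘ cov) (∈-allFin v)))
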